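{- Let $G_1=(V_1,E_1)$ and $G_2=(V_2,E_2)$ be finite, simple, connected graphs with disjoint vertex sets, and let $u_1\in V_1$, $u_2\in V_2$. Let $\mathcal{S}=\mathcal{S}(G_1,G_2;u_1,u_2)$ be the splice graph obtained from the disjoint union of $G_1$ and $G_2$ by identifying $u_1$ and $u_2$. For $i=1,2$ let $S_i=\{f=xy\in E_i : d_{G_i}(x,u_i)=d_{G_i}(y,u_i)\}$, $T_i=E_i\setminus S_i$ and $t_i=|T_i|$. Then $$PI(\mathcal{S}) = PI(G_1)+PI(G_2) + t_2|E_1| + t_1|E_2|.$$
   Context: For a connected graph $G$, $d_G(x,y)$ denotes the distance between vertices $x,y$, and for an edge $g=ab$ and a vertex $u$, $d_G(g,u)=\min\{d_G(a,u),d_G(b,u)\}$. For an edge $e=uv$ of $G$, $m_u(e)$ is the number of edges $g$ of $G$ with $d_G(g,u)<d_G(g,v)$, and $m_v(e)$ is defined analogously. The (edge-)PI index is $PI(G)=\sum_{e=uv\in E(G)} \big[m_u(e)+m_v(e)\big]$. In the splice graph, the edge set is the disjoint union $E_1\cup E_2$. -}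

module Defs where

open import Data.Nat using (ℕ; zero; suc; _+_; _⊔_; _⊓_; _≡ᵇ_; _<ᵇ_; _≤_)
open import Data.Bool using (Bool; true; false; _∨_; _∧_; not; if_then_else_)
open import Data.List using (List; []; _∷_; _++_; map; length; filterᵇ)
open import Data.Bool.ListAction using (any)
open import Data.Nat.ListAction using (sum)
open import Data.List.Membership.Propositional using (_∈_; _∉_)
open import Data.List.Relation.Unary.All using (All)
open import Data.List.Relation.Unary.AllPairs using (AllPairs)
open import Data.List.Relation.Unary.Unique.Propositional using (Unique)
open import Data.Product using (_×_; _,_; ∃)
open import Data.Sum using (_⊎_)
open import Relation.Binary.PropositionalEquality using (_≡_; _≢_)
open import Relation.Nullary using (¬_)

-- A finite graph with vertices labelled by natural numbers:
-- a list of vertices and a list of edges (each edge listed once, as an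
-- ordered pair representing the unordered pair {x , y}).
record Graph : Set where
  constructor mkGraph
  field
    verts : List ℕ
    edges : List (ℕ × ℕ)
open Graph public

Edge : Set
Edge = ℕ × ℕ

SameEdge : Edge → Edge → Set
SameEdge (a , b) (c , d) = (a ≡ c × b ≡ d) ⊎ (a ≡ d × b ≡ c)

record Simple (G : Graph) : Set where
  field
    vertsUnique : Unique (verts G)
    edgesValid  : All (λ e → (Data.Product.proj₁ e ∈ verts G) × (Data.Product.proj₂ e ∈ verts G)
                           × (Data.Product.proj₁ e ≢ Data.Product.proj₂ e)) (edges G)
    noMultiEdge : AllPairs (λ e f → ¬ SameEdge e f) (edges G)

Adjacent : Graph → ℕ → ℕ → Set
Adjacent G x y = ((x , y) ∈ edges G) ⊎ ((y , x) ∈ edges G)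

data Walk (G : Graph) : ℕ → ℕ → ℕ → Set where
  here : ∀ {x} → Walk G zero x x
  step : ∀ {k x z y} → Adjacent G x z → Walk G k z y → Walk G (suc k) x y

Connected : Graph → Set
Connected G = ∀ x y → x ∈ verts G → y ∈ verts G → ∃ λ k → Walk G k x y

-- reach G k x y = true iff there is a walk of length ≤ k from x to y
reach : Graph → ℕ → ℕ → ℕ → Bool
reach G zero x y = x ≡ᵇ y
reach G (suc k) x y =
  reach G k x y ∨
  any (λ e → (reach G k x (Data.Product.proj₁ e) ∧ (Data.Product.proj₂ e ≡ᵇ y))
           ∨ (reach G k x (Data.Product.proj₂ e) ∧ (Data.Product.proj₁ e ≡ᵇ y)))
      (edges G)

-- least k in [s, s + fuel) with f k = true, or s + fuel if none
leastFrom : (ℕ → Bool) → ℕ → ℕ → ℕ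
leastFrom f zero s = s
leastFrom f (suc fuel) s = if f s then s else leastFrom f fuel (suc s)

-- d_G(x,y): length of a shortest walk from x to y (in a connected graph
-- with n vertices this is < n; the fallback value n is never used there)
dist : Graph → ℕ → ℕ → ℕ
dist G x y = leastFrom (λ k → reach G k x y) (length (verts G)) zero

distE : Graph → Edge → ℕ → ℕ
distE G (a , b) u = dist G a u ⊓ dist G b u

count : {A : Set} → (A → Bool) → List A → ℕ
count p xs = length (filterᵇ p xs)

m : Graph → ℕ → ℕ → ℕ
m G u v = count (λ g → distE G g u <ᵇ distE G g v) (edges G)

PI : Graph → ℕ
PI G = sum (map (λ e → m G (Data.Product.proj₁ e) (Data.Product.proj₂ e)
                      + m G (Data.Product.proj₂ e) (Data.Product.proj₁ e)) (edges G))

Tset : Graph → ℕ → List Edge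
Tset G u = filterᵇ (λ e → not (dist G (Data.Product.proj₁ e) u ≡ᵇ dist G (Data.Product.proj₂ e) u)) (edges G)

tcount : Graph → ℕ → ℕ
tcount G u = length (Tset G u)

ren : ℕ → ℕ → ℕ → ℕ
ren u₁ u₂ v = if v ≡ᵇ u₂ then u₁ else v

splice : Graph → Graph → ℕ → ℕ → Graph
splice G₁ G₂ u₁ u₂ = mkGraph
  (verts G₁ ++ filterᵇ (λ v → not (v ≡ᵇ u₂)) (verts G₂))
  (edges G₁ ++ map (λ e → ren u₁ u₂ (Data.Product.proj₁ e) , ren u₁ u₂ (Data.Product.proj₂ e)) (edges G₂))

Disjoint : List ℕ → List ℕ → Set
Disjoint xs ys = ∀ v → v ∈ xs → v ∉ ys

-- Write π₁, π₂ for the projections of the splice S onto G₁ and G₂ that collapse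
-- the other graph to the cut vertex. Every edge of S moves exactly one of the two
-- projections, along an edge of its graph, so a walk in S splits into a walk in
-- G₁ and a walk in G₂; conversely two geodesics joined at the cut vertex form a
-- walk in S. Hence d_S(s, t) = d₁(π₁ s, π₁ t) + d₂(π₂ s, π₂ t). For an edge ab of
-- G₁ an edge g of G₁ sees a and b exactly as in G₁, while every edge g of G₂
-- satisfies d_S(g, a) = d₁(a, u₁) + d_{G₂}(g, u₂), so all of E₂ is counted in
-- m_a(ab) or in m_b(ab) exactly when d₁(a, u₁) ≠ d₁(b, u₁), i.e. when ab ∈ T₁;
-- symmetrically for the edges of G₂.
module Submission where

open import Defs
open import Data.Bool using (Bool; true; false; T; not; if_then_else_; _∧_; _∨_)
open import Data.Bool.Properties using (T-∨; T-∧; T-not-≡)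
open import Data.Empty using (⊥-elim)
open import Data.List using (List; []; _∷_; _++_; map; length; filterᵇ)
open import Data.List.Properties using (length-++; filter-++; filter-all; map-++; map-∘; map-cong-local; length-removeAt′)
open import Data.List.Membership.Propositional using (_∈_; _∉_; find; lose; _─_)
open import Data.List.Membership.Propositional.Properties using (∈-map⁺; ∈-map⁻; ∈-++⁺ˡ; ∈-++⁺ʳ; ∈-++⁻)
open import Data.List.Relation.Binary.Subset.Propositional using (_⊆_)
open import Data.List.Relation.Unary.All as All using (All; []; _∷_)
open import Data.List.Relation.Unary.All.Properties.Core using (¬Any⇒All¬)
open import Data.List.Relation.Unary.AllPairs using ([]; _∷_)
open import Data.List.Relation.Unary.Any using (here; there; index)
open import Data.List.Relation.Unary.Any.Properties using (any⁺; any⁻)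
open import Data.List.Relation.Unary.Unique.Propositional using (Unique)
open import Data.Nat using (ℕ; zero; suc; _+_; _*_; _≤_; _<_; z≤n; s≤s; s≤s⁻¹; _≡ᵇ_; _<ᵇ_; _⊓_)
open import Data.Nat.Properties
open import Algebra.Properties.CommutativeSemigroup +-commutativeSemigroup using (interchange)
open import Data.Nat.ListAction using (sum)
open import Data.Nat.ListAction.Properties using (sum-++)
open import Data.Product using (_×_; _,_; ∃₂; proj₁; proj₂)
open import Data.Sum using (_⊎_; inj₁; inj₂)
open import Data.List.Membership.DecPropositional _≟_ using (_∈?_)
open import Function using (_∘_; Equivalence)
open import Relation.Nullary using (yes; no; does)
open import Relation.Nullary.Decidable using (T?; dec-true; dec-false)
open import Relation.Binary.PropositionalEquality

open Equivalence using (to; from)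

indicator : Bool → ℕ → ℕ
indicator b n = if b then n else 0

count-++ : ∀ {A : Set} (p : A → Bool) xs ys → count p (xs ++ ys) ≡ count p xs + count p ys
count-++ p xs ys = trans (cong length (filter-++ (T? ∘ p) xs ys)) (length-++ (filterᵇ p xs))

count-map : ∀ {A B : Set} (p : B → Bool) (f : A → B) xs → count p (map f xs) ≡ count (p ∘ f) xs
count-map p f [] = refl
count-map p f (x ∷ xs) with p (f x)
... | true  = cong suc (count-map p f xs)
... | false = count-map p f xs

count-cong : ∀ {A : Set} {p q : A → Bool} xs → (∀ {x} → x ∈ xs → p x ≡ q x) → count p xs ≡ count q xs
count-cong [] p≗q = refl
count-cong {p = p} {q} (x ∷ xs) p≗q with p x | q x | p≗q (here refl)
... | true  | true  | refl = cong suc (count-cong xs (p≗q ∘ there))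
... | false | false | refl = count-cong xs (p≗q ∘ there)

count-const : ∀ {A : Set} {p : A → Bool} {b} xs → (∀ {x} → x ∈ xs → p x ≡ b) →
              count p xs ≡ indicator b (length xs)
count-const {b = true}  []       p≡b = refl
count-const {b = false} []       p≡b = refl
count-const {p = p} {b} (x ∷ xs) p≡b with p x | p≡b (here refl) | count-const xs (p≡b ∘ there)
... | true  | refl | ih = cong suc ih
... | false | refl | ih = ih

sum-map-+ : ∀ {A : Set} (f g : A → ℕ) xs → sum (map (λ x → f x + g x) xs) ≡ sum (map f xs) + sum (map g xs)
sum-map-+ f g []       = refl
sum-map-+ f g (x ∷ xs) = trans (cong (f x + g x +_) (sum-map-+ f g xs)) (interchange (f x) (g x) _ _)

sum-map-indicator : ∀ {A : Set} (p : A → Bool) n xs → sum (map (λ x → indicator (p x) n) xs) ≡ count p xs * n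
sum-map-indicator p n []       = refl
sum-map-indicator p n (x ∷ xs) with p x
... | true  = cong (n +_) (sum-map-indicator p n xs)
... | false = sum-map-indicator p n xs

sum-map-split : ∀ {A : Set} (f g : A → ℕ) (p : A → Bool) n xs →
                (∀ {x} → x ∈ xs → f x ≡ g x + indicator (p x) n) →
                sum (map f xs) ≡ sum (map g xs) + count p xs * n
sum-map-split f g p n xs f≡g+ = begin
  sum (map f xs)                                     ≡⟨ cong sum (map-cong-local (All.tabulate f≡g+)) ⟩
  sum (map (λ x → g x + indicator (p x) n) xs)       ≡⟨ sum-map-+ g (λ x → indicator (p x) n) xs ⟩
  sum (map g xs) + sum (map (λ x → indicator (p x) n) xs) ≡⟨ cong (sum (map g xs) +_) (sum-map-indicator p n xs) ⟩
  sum (map g xs) + count p xs * n                    ∎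
  where open ≡-Reasoning

+-cancelˡ-<ᵇ : ∀ k m n → (k + m <ᵇ k + n) ≡ (m <ᵇ n)
+-cancelˡ-<ᵇ zero    m n = refl
+-cancelˡ-<ᵇ (suc k) m n = +-cancelˡ-<ᵇ k m n

+-cancelʳ-<ᵇ : ∀ k m n → (m + k <ᵇ n + k) ≡ (m <ᵇ n)
+-cancelʳ-<ᵇ k m n rewrite +-comm m k | +-comm n k = +-cancelˡ-<ᵇ k m n

indicator-<ᵇ-+-indicator->ᵇ : ∀ x y n → indicator (x <ᵇ y) n + indicator (y <ᵇ x) n ≡ indicator (not (x ≡ᵇ y)) n
indicator-<ᵇ-+-indicator->ᵇ zero    zero    n = refl
indicator-<ᵇ-+-indicator->ᵇ zero    (suc y) n = +-identityʳ n
indicator-<ᵇ-+-indicator->ᵇ (suc x) zero    n = refl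
indicator-<ᵇ-+-indicator->ᵇ (suc x) (suc y) n = indicator-<ᵇ-+-indicator->ᵇ x y n

∈-─⁺ : ∀ {x y : ℕ} {xs} (x∈xs : x ∈ xs) → y ∈ xs → y ≢ x → y ∈ xs ─ x∈xs
∈-─⁺ (here refl) (here refl) y≢x = ⊥-elim (y≢x refl)
∈-─⁺ (here refl) (there y∈)  _   = y∈
∈-─⁺ (there x∈)  (here refl) _   = here refl
∈-─⁺ (there x∈)  (there y∈)  y≢x = there (∈-─⁺ x∈ y∈ y≢x)

unique⊆⇒length≤ : ∀ {xs ys : List ℕ} → Unique xs → xs ⊆ ys → length xs ≤ length ys
unique⊆⇒length≤ {[]}     _          _     = z≤n
unique⊆⇒length≤ {x ∷ xs} {ys} (x∉xs ∷ u) xs⊆ys =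
  subst (suc (length xs) ≤_) (sym (length-removeAt′ ys (index x∈ys)))
        (s≤s (unique⊆⇒length≤ u λ v∈xs →
          ∈-─⁺ x∈ys (xs⊆ys (there v∈xs)) (λ v≡x → All.lookup x∉xs v∈xs (sym v≡x))))
  where
  x∈ys : x ∈ ys
  x∈ys = xs⊆ys (here refl)

-- does (m ≟ n) is definitionally m ≡ᵇ n, so dec-true and dec-false evaluate _≡ᵇ_.
length-filter-≢ᵇ : ∀ {u} ys → Unique ys → u ∈ ys → suc (length (filterᵇ (λ v → not (v ≡ᵇ u)) ys)) ≡ length ys
length-filter-≢ᵇ {u} (u ∷ ys) (u∉ys ∷ _) (here refl) rewrite dec-true (u ≟ u) refl =
  cong (suc ∘ length) (filter-all (T? ∘ λ v → not (v ≡ᵇ u)) (All.map (λ u≢v → from T-not-≡ (dec-false (_ ≟ u) (u≢v ∘ sym))) u∉ys))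
length-filter-≢ᵇ {u} (y ∷ ys) (y∉ys ∷ uniq) (there u∈) rewrite dec-false (y ≟ u) (All.lookup y∉ys u∈) =
  cong suc (length-filter-≢ᵇ ys uniq u∈)

leastFrom-≤ : ∀ (f : ℕ → Bool) fuel s {k} → T (f k) → s ≤ k → leastFrom f fuel s ≤ k
leastFrom-≤ f zero       s fk s≤k = s≤k
leastFrom-≤ f (suc fuel) s fk s≤k with f s in fs
... | true  = s≤k
... | false = leastFrom-≤ f fuel (suc s) fk (≤∧≢⇒< s≤k λ { refl → subst T fs fk })

leastFrom-sat : ∀ (f : ℕ → Bool) fuel s {k} → T (f k) → s ≤ k → k < s + fuel → T (f (leastFrom f fuel s))
leastFrom-sat f zero       s fk s≤k k< = ⊥-elim (<⇒≱ k< (≤-trans (≤-reflexive (+-identityʳ s)) s≤k))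
leastFrom-sat f (suc fuel) s {k} fk s≤k k< with f s in fs
... | true  = subst T (sym fs) _
... | false = leastFrom-sat f fuel (suc s) fk (≤∧≢⇒< s≤k λ { refl → subst T fs fk }) (subst (k <_) (+-suc s fuel) k<)

module _ {G : Graph} where

  adjacent-sym : ∀ {x y} → Adjacent G x y → Adjacent G y x
  adjacent-sym (inj₁ xy) = inj₂ xy
  adjacent-sym (inj₂ yx) = inj₁ yx

  snoc : ∀ {k x y z} → Walk G k x y → Adjacent G y z → Walk G (suc k) x z
  snoc here       a = step a here
  snoc (step b w) a = step b (snoc w a)

  reverse : ∀ {k x y} → Walk G k x y → Walk G k y x
  reverse here       = here
  reverse (step a w) = snoc (reverse w) (adjacent-sym a)

  infixr 5 _++ʷ_
  _++ʷ_ : ∀ {j k x y z} → Walk G j x y → Walk G k y z → Walk G (j + k) x z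
  here     ++ʷ w′ = w′
  step a w ++ʷ w′ = step a (w ++ʷ w′)

  extendsTo : ℕ → ℕ → ℕ → Edge → Bool
  extendsTo k x y e = (reach G k x (proj₁ e) ∧ (proj₂ e ≡ᵇ y)) ∨ (reach G k x (proj₂ e) ∧ (proj₁ e ≡ᵇ y))

  reach-sound : ∀ k x y → T (reach G k x y) → ∃₂ λ j (w : Walk G j x y) → j ≤ k
  reach-sound zero x y r with ≡ᵇ⇒≡ x y r
  ... | refl = 0 , here , z≤n
  reach-sound (suc k) x y r with to T-∨ r
  ... | inj₁ r′ with reach-sound k x y r′
  ... | j , w , j≤k = j , w , m≤n⇒m≤1+n j≤k
  reach-sound (suc k) x y r | inj₂ r′ with find (any⁻ (extendsTo k x y) (edges G) r′)
  ... | (a , b) , ab∈ , ext with to T-∨ ext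
  ... | inj₁ ext₁ with to T-∧ ext₁
  ... | ra , b≡y with ≡ᵇ⇒≡ b y b≡y | reach-sound k x a ra
  ... | refl | j , w , j≤k = suc j , snoc w (inj₁ ab∈) , s≤s j≤k
  reach-sound (suc k) x y r | inj₂ r′ | (a , b) , ab∈ , ext | inj₂ ext₂ with to T-∧ ext₂
  ... | rb , a≡y with ≡ᵇ⇒≡ a y a≡y | reach-sound k x b rb
  ... | refl | j , w , j≤k = suc j , snoc w (inj₂ ab∈) , s≤s j≤k

  reach-step : ∀ {j x z z′} → T (reach G j x z) → Adjacent G z z′ → T (reach G (suc j) x z′)
  reach-step {j} {x} {z} {z′} r (inj₁ zz′) =
    from T-∨ (inj₂ (any⁺ (extendsTo j x z′) (lose zz′ (from T-∨ (inj₁ (from T-∧ (r , ≡⇒≡ᵇ z′ z′ refl)))))))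
  reach-step {j} {x} {z} {z′} r (inj₂ z′z) =
    from T-∨ (inj₂ (any⁺ (extendsTo j x z′) (lose z′z (from T-∨ (inj₂ (from T-∧ (r , ≡⇒≡ᵇ z′ z′ refl)))))))

  reach-++ : ∀ {j k x z y} → T (reach G j x z) → Walk G k z y → T (reach G (j + k) x y)
  reach-++ {j} {x = x} {y = y} r here = subst (λ n → T (reach G n x y)) (sym (+-identityʳ j)) r
  reach-++ {j} {suc k} {x} {y = y} r (step a w) =
    subst (λ n → T (reach G n x y)) (sym (+-suc j k)) (reach-++ {suc j} (reach-step {j} {x} r a) w)

  reach-complete : ∀ {k x y} → Walk G k x y → T (reach G k x y)
  reach-complete {x = x} = reach-++ {j = 0} (≡⇒≡ᵇ x x refl)

  dist-≤ : ∀ {k x y} → Walk G k x y → dist G x y ≤ k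
  dist-≤ {x = x} {y} w = leastFrom-≤ (λ j → reach G j x y) (length (verts G)) 0 (reach-complete w) z≤n

  dist-refl : ∀ x → dist G x x ≡ 0
  dist-refl x = n≤0⇒n≡0 (dist-≤ (here {x = x}))

  geodesic-of : ∀ {k x y} → Walk G k x y → k < length (verts G) → Walk G (dist G x y) x y
  geodesic-of {x = x} {y} w k<n
    with reach-sound (dist G x y) x y (leastFrom-sat (λ j → reach G j x y) (length (verts G)) 0 (reach-complete w) z≤n k<n)
  ... | j , w′ , j≤dist = subst (λ n → Walk G n x y) (≤-antisym j≤dist (dist-≤ w′)) w′

  dist-shortest : ∀ {D x y} → Walk G D x y → D < length (verts G) → (∀ {k} → Walk G k x y → D ≤ k) → dist G x y ≡ D
  dist-shortest w D<n minimal = ≤-antisym (dist-≤ w) (minimal (geodesic-of w D<n))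

  vertices : ∀ {k x y} → Walk G k x y → List ℕ
  vertices (here {x}) = x ∷ []
  vertices (step {x = x} _ w) = x ∷ vertices w

  length-vertices : ∀ {k x y} (w : Walk G k x y) → length (vertices w) ≡ suc k
  length-vertices here       = refl
  length-vertices (step _ w) = cong suc (length-vertices w)

  Path : ℕ → ℕ → Set
  Path x y = ∃₂ λ k (w : Walk G k x y) → Unique (vertices w)

  path-from : ∀ {k x z y} (w : Walk G k z y) → x ∈ vertices w → Unique (vertices w) → Path x y
  path-from here       (here refl) u       = 0 , here , u
  path-from (step a w) (here refl) u       = _ , step a w , u
  path-from (step a w) (there x∈)  (_ ∷ u) = path-from w x∈ u

  walk⇒path : ∀ {k x y} → Walk G k x y → Path x y
  walk⇒path here = 0 , here , [] ∷ []
  walk⇒path (step {x = x} a w) with walk⇒path w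
  ... | j , w′ , u with x ∈? vertices w′
  ... | yes x∈ = path-from w′ x∈ u
  ... | no  x∉ = suc j , step a w′ , ¬Any⇒All¬ _ x∉ ∷ u

module _ {G H : Graph} (f : ℕ → ℕ) (f-edge : ∀ {x y} → (x , y) ∈ edges G → (f x , f y) ∈ edges H) where

  map-walk : ∀ {k x y} → Walk G k x y → Walk H k (f x) (f y)
  map-walk here               = here
  map-walk (step (inj₁ xz) w) = step (inj₁ (f-edge xz)) (map-walk w)
  map-walk (step (inj₂ zx) w) = step (inj₂ (f-edge zx)) (map-walk w)

module _ {G : Graph} (simple : Simple G) where

  edge-endpoints : ∀ {x y} → (x , y) ∈ edges G → x ∈ verts G × y ∈ verts G
  edge-endpoints xy∈ with All.lookup (Simple.edgesValid simple) xy∈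
  ... | x∈ , y∈ , _ = x∈ , y∈

  vertices⊆ : ∀ {k x y} → x ∈ verts G → (w : Walk G k x y) → vertices w ⊆ verts G
  vertices⊆ x∈ here                 (here refl) = x∈
  vertices⊆ x∈ (step _ w)           (here refl) = x∈
  vertices⊆ x∈ (step (inj₁ xz) w)   (there v∈)  = vertices⊆ (proj₂ (edge-endpoints xz)) w v∈
  vertices⊆ x∈ (step (inj₂ zx) w)   (there v∈)  = vertices⊆ (proj₁ (edge-endpoints zx)) w v∈

  path-length< : ∀ {k x y} → x ∈ verts G → (w : Walk G k x y) → Unique (vertices w) → k < length (verts G)
  path-length< x∈ w u = subst (_≤ length (verts G)) (length-vertices w) (unique⊆⇒length≤ u (vertices⊆ x∈ w))

module Geodesic (G : Graph) (simple : Simple G) (connected : Connected G) where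

  short-walk : ∀ {x y} → x ∈ verts G → y ∈ verts G → ∃₂ λ k (w : Walk G k x y) → k < length (verts G)
  short-walk x∈ y∈ with walk⇒path (proj₂ (connected _ _ x∈ y∈))
  ... | k , w , u = k , w , path-length< simple x∈ w u

  geodesic : ∀ {x y} → x ∈ verts G → y ∈ verts G → Walk G (dist G x y) x y
  geodesic x∈ y∈ with short-walk x∈ y∈
  ... | _ , w , k<n = geodesic-of w k<n

  dist< : ∀ {x y} → x ∈ verts G → y ∈ verts G → dist G x y < length (verts G)
  dist< x∈ y∈ with short-walk x∈ y∈
  ... | _ , w , k<n = ≤-<-trans (dist-≤ w) k<n

  dist-sym : ∀ {x y} → x ∈ verts G → y ∈ verts G → dist G x y ≡ dist G y x
  dist-sym x∈ y∈ = ≤-antisym (dist-≤ (reverse (geodesic y∈ x∈))) (dist-≤ (reverse (geodesic x∈ y∈)))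

edgePI : Graph → Edge → ℕ
edgePI G e = m G (proj₁ e) (proj₂ e) + m G (proj₂ e) (proj₁ e)

+-indicators-<ᵇ : ∀ {p q p′ q′} x y n → p ≡ q + indicator (x <ᵇ y) n → p′ ≡ q′ + indicator (y <ᵇ x) n →
               p + p′ ≡ (q + q′) + indicator (not (x ≡ᵇ y)) n
+-indicators-<ᵇ {q = q} {q′ = q′} x y n refl refl =
  trans (interchange q _ q′ _) (cong (q + q′ +_) (indicator-<ᵇ-+-indicator->ᵇ x y n))

module Splice (G₁ G₂ : Graph) (simple₁ : Simple G₁) (simple₂ : Simple G₂)
              (connected₁ : Connected G₁) (connected₂ : Connected G₂)
              (disjoint : Disjoint (verts G₁) (verts G₂))
              (u₁ u₂ : ℕ) (u₁∈ : u₁ ∈ verts G₁) (u₂∈ : u₂ ∈ verts G₂) where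

  S : Graph
  S = splice G₁ G₂ u₁ u₂

  V₁ V₂ : List ℕ
  V₁ = verts G₁
  V₂ = verts G₂

  E₁ E₂ : List Edge
  E₁ = edges G₁
  E₂ = edges G₂

  d₁ d₂ : ℕ → ℕ → ℕ
  d₁ = dist G₁
  d₂ = dist G₂

  r : ℕ → ℕ
  r = ren u₁ u₂

  R : Edge → Edge
  R e = r (proj₁ e) , r (proj₂ e)

  module Geo₁ = Geodesic G₁ simple₁ connected₁
  module Geo₂ = Geodesic G₂ simple₂ connected₂

  r-u₂ : r u₂ ≡ u₁
  r-u₂ rewrite dec-true (u₂ ≟ u₂) refl = refl

  r-≢ : ∀ {c} → c ≢ u₂ → r c ≡ c
  r-≢ {c} c≢u₂ rewrite dec-false (c ≟ u₂) c≢u₂ = refl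

  π₁ π₂ : ℕ → ℕ
  π₁ v = if does (v ∈? V₁) then v else u₁
  π₂ v = if does (v ∈? V₂) then v else u₂

  π₁-∈ : ∀ {v} → v ∈ V₁ → π₁ v ≡ v
  π₁-∈ {v} v∈ with v ∈? V₁
  ... | yes _ = refl
  ... | no v∉ = ⊥-elim (v∉ v∈)

  π₁-∉ : ∀ {v} → v ∉ V₁ → π₁ v ≡ u₁
  π₁-∉ {v} v∉ with v ∈? V₁
  ... | yes v∈ = ⊥-elim (v∉ v∈)
  ... | no _   = refl

  π₂-∈ : ∀ {v} → v ∈ V₂ → π₂ v ≡ v
  π₂-∈ {v} v∈ with v ∈? V₂
  ... | yes _ = refl
  ... | no v∉ = ⊥-elim (v∉ v∈)

  π₂-∉ : ∀ {v} → v ∉ V₂ → π₂ v ≡ u₂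
  π₂-∉ {v} v∉ with v ∈? V₂
  ... | yes v∈ = ⊥-elim (v∉ v∈)
  ... | no _   = refl

  π₂-V₁ : ∀ {a} → a ∈ V₁ → π₂ a ≡ u₂
  π₂-V₁ a∈ = π₂-∉ (disjoint _ a∈)

  π₁-r : ∀ {c} → c ∈ V₂ → π₁ (r c) ≡ u₁
  π₁-r {c} c∈ with c ≟ u₂
  ... | yes refl rewrite r-u₂ = π₁-∈ u₁∈
  ... | no c≢u₂ rewrite r-≢ c≢u₂ = π₁-∉ λ c∈V₁ → disjoint c c∈V₁ c∈

  π₂-r : ∀ {c} → c ∈ V₂ → π₂ (r c) ≡ c
  π₂-r {c} c∈ with c ≟ u₂
  ... | yes refl rewrite r-u₂ = π₂-V₁ u₁∈
  ... | no c≢u₂ rewrite r-≢ c≢u₂ = π₂-∈ c∈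

  data SpliceVertex : ℕ → Set where
    from₁ : ∀ {a} → a ∈ V₁ → SpliceVertex a
    from₂ : ∀ {c} → c ∈ V₂ → SpliceVertex (r c)

  π₁∈ : ∀ {s} → SpliceVertex s → π₁ s ∈ V₁
  π₁∈ (from₁ a∈) rewrite π₁-∈ a∈ = a∈
  π₁∈ (from₂ c∈) rewrite π₁-r c∈ = u₁∈

  π₂∈ : ∀ {s} → SpliceVertex s → π₂ s ∈ V₂
  π₂∈ (from₁ a∈) rewrite π₂-V₁ a∈ = u₂∈
  π₂∈ (from₂ c∈) rewrite π₂-r c∈ = c∈

  ProjectedStep : ℕ → ℕ → Set
  ProjectedStep x y = (Adjacent G₁ (π₁ x) (π₁ y) × π₂ x ≡ π₂ y) ⊎ (π₁ x ≡ π₁ y × Adjacent G₂ (π₂ x) (π₂ y))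

  edge-projection : ∀ {x y} → (x , y) ∈ edges S → ProjectedStep x y
  edge-projection xy∈ with ∈-++⁻ E₁ xy∈
  ... | inj₁ xy∈E₁ with edge-endpoints simple₁ xy∈E₁
  ... | x∈ , y∈ rewrite π₁-∈ x∈ | π₁-∈ y∈ | π₂-V₁ x∈ | π₂-V₁ y∈ = inj₁ (inj₁ xy∈E₁ , refl)
  edge-projection xy∈ | inj₂ xy∈RE₂ with ∈-map⁻ R xy∈RE₂
  ... | (c , d) , cd∈ , refl with edge-endpoints simple₂ cd∈
  ... | c∈ , d∈ rewrite π₁-r c∈ | π₁-r d∈ | π₂-r c∈ | π₂-r d∈ = inj₂ (refl , inj₁ cd∈)

  projected-sym : ∀ {x y} → ProjectedStep x y → ProjectedStep y x
  projected-sym (inj₁ (a , e)) = inj₁ (adjacent-sym {G₁} a , sym e)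
  projected-sym (inj₂ (e , a)) = inj₂ (sym e , adjacent-sym {G₂} a)

  adjacent-projection : ∀ {x y} → Adjacent S x y → ProjectedStep x y
  adjacent-projection (inj₁ xy∈) = edge-projection xy∈
  adjacent-projection (inj₂ yx∈) = projected-sym (edge-projection yx∈)

  walk-projection : ∀ {k s t} → Walk S k s t →
    ∃₂ λ a b → a + b ≡ k × Walk G₁ a (π₁ s) (π₁ t) × Walk G₂ b (π₂ s) (π₂ t)
  walk-projection here = 0 , 0 , refl , here , here
  walk-projection {t = t} (step st w) with walk-projection w | adjacent-projection st
  ... | a , b , refl , w₁ , w₂ | inj₁ (st₁ , e₂) =
    suc a , b , refl , step st₁ w₁ , subst (λ v → Walk G₂ b v (π₂ t)) (sym e₂) w₂
  ... | a , b , refl , w₁ , w₂ | inj₂ (e₁ , st₂) =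
    a , suc b , +-suc a b , subst (λ v → Walk G₁ a v (π₁ t)) (sym e₁) w₁ , step st₂ w₂

  embed₁ : ∀ {k x y} → Walk G₁ k x y → Walk S k x y
  embed₁ = map-walk (λ x → x) ∈-++⁺ˡ

  embed₂ : ∀ {k x y} → Walk G₂ k x y → Walk S k (r x) (r y)
  embed₂ = map-walk r (∈-++⁺ʳ E₁ ∘ ∈-map⁺ R)

  splitDist : ℕ → ℕ → ℕ
  splitDist s t = d₁ (π₁ s) (π₁ t) + d₂ (π₂ s) (π₂ t)

  splitDist-≤ : ∀ {k s t} → Walk S k s t → splitDist s t ≤ k
  splitDist-≤ w with walk-projection w
  ... | a , b , refl , w₁ , w₂ = +-mono-≤ (dist-≤ w₁) (dist-≤ w₂)

  walk-from-u₁ : ∀ {c} → c ∈ V₂ → Walk S (d₂ u₂ c) u₁ (r c)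
  walk-from-u₁ {c} c∈ = subst (λ v → Walk S (d₂ u₂ c) v (r c)) r-u₂ (embed₂ (Geo₂.geodesic u₂∈ c∈))

  splitDist-walk : ∀ {s t} → SpliceVertex s → SpliceVertex t → Walk S (splitDist s t) s t
  splitDist-walk (from₁ a∈) (from₁ b∈)
    rewrite π₁-∈ a∈ | π₁-∈ b∈ | π₂-V₁ a∈ | π₂-V₁ b∈ | dist-refl {G₂} u₂ =
    embed₁ (Geo₁.geodesic a∈ b∈) ++ʷ here
  splitDist-walk (from₁ a∈) (from₂ d∈)
    rewrite π₁-∈ a∈ | π₁-r d∈ | π₂-V₁ a∈ | π₂-r d∈ =
    embed₁ (Geo₁.geodesic a∈ u₁∈) ++ʷ walk-from-u₁ d∈
  splitDist-walk (from₂ {c} c∈) (from₁ {b} b∈)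
    rewrite π₁-r c∈ | π₁-∈ b∈ | π₂-r c∈ | π₂-V₁ b∈ | Geo₂.dist-sym c∈ u₂∈ =
    subst (λ n → Walk S n (r c) b) (+-comm (d₂ u₂ c) (d₁ u₁ b)) (reverse (walk-from-u₁ c∈) ++ʷ embed₁ (Geo₁.geodesic u₁∈ b∈))
  splitDist-walk (from₂ c∈) (from₂ d∈)
    rewrite π₁-r c∈ | π₁-r d∈ | π₂-r c∈ | π₂-r d∈ | dist-refl {G₁} u₁ =
    embed₂ (Geo₂.geodesic c∈ d∈)

  splitDist< : ∀ {s t} → SpliceVertex s → SpliceVertex t → splitDist s t < length (verts S)
  splitDist< {s} {t} s∈ t∈ =
    subst (splitDist s t <_) (sym (length-++ V₁))
      (+-mono-<-≤ (Geo₁.dist< (π₁∈ s∈) (π₁∈ t∈))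
                  (s≤s⁻¹ (subst (d₂ (π₂ s) (π₂ t) <_) (sym (length-filter-≢ᵇ V₂ (Simple.vertsUnique simple₂) u₂∈))
                                 (Geo₂.dist< (π₂∈ s∈) (π₂∈ t∈)))))

  dist-splice : ∀ {s t} → SpliceVertex s → SpliceVertex t → dist S s t ≡ splitDist s t
  dist-splice s∈ t∈ = dist-shortest (splitDist-walk s∈ t∈) (splitDist< s∈ t∈) splitDist-≤

  dist-splice-V₁ : ∀ {a b} → a ∈ V₁ → b ∈ V₁ → dist S a b ≡ d₁ a b
  dist-splice-V₁ {a} {b} a∈ b∈
    rewrite dist-splice (from₁ a∈) (from₁ b∈) | π₁-∈ a∈ | π₁-∈ b∈ | π₂-V₁ a∈ | π₂-V₁ b∈ | dist-refl {G₂} u₂ =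
    +-identityʳ (d₁ a b)

  dist-splice-V₂ : ∀ {c d} → c ∈ V₂ → d ∈ V₂ → dist S (r c) (r d) ≡ d₂ c d
  dist-splice-V₂ c∈ d∈
    rewrite dist-splice (from₂ c∈) (from₂ d∈) | π₁-r c∈ | π₁-r d∈ | π₂-r c∈ | π₂-r d∈ | dist-refl {G₁} u₁ = refl

  dist-splice-V₂V₁ : ∀ {c a} → c ∈ V₂ → a ∈ V₁ → dist S (r c) a ≡ d₁ a u₁ + d₂ c u₂
  dist-splice-V₂V₁ c∈ a∈
    rewrite dist-splice (from₂ c∈) (from₁ a∈) | π₁-r c∈ | π₁-∈ a∈ | π₂-r c∈ | π₂-V₁ a∈ | Geo₁.dist-sym u₁∈ a∈ = refl

  dist-splice-V₁V₂ : ∀ {a c} → a ∈ V₁ → c ∈ V₂ → dist S a (r c) ≡ d₁ a u₁ + d₂ c u₂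
  dist-splice-V₁V₂ a∈ c∈
    rewrite dist-splice (from₁ a∈) (from₂ c∈) | π₁-∈ a∈ | π₁-r c∈ | π₂-V₁ a∈ | π₂-r c∈ | Geo₂.dist-sym u₂∈ c∈ = refl

  distE-E₁-V₁ : ∀ {g a} → g ∈ E₁ → a ∈ V₁ → distE S g a ≡ distE G₁ g a
  distE-E₁-V₁ {x , y} g∈ a∈ with edge-endpoints simple₁ g∈
  ... | x∈ , y∈ = cong₂ _⊓_ (dist-splice-V₁ x∈ a∈) (dist-splice-V₁ y∈ a∈)

  distE-E₂-V₁ : ∀ {g a} → g ∈ E₂ → a ∈ V₁ → distE S (R g) a ≡ d₁ a u₁ + distE G₂ g u₂
  distE-E₂-V₁ {x , y} {a} g∈ a∈ with edge-endpoints simple₂ g∈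
  ... | x∈ , y∈ = trans (cong₂ _⊓_ (dist-splice-V₂V₁ x∈ a∈) (dist-splice-V₂V₁ y∈ a∈))
                        (sym (+-distribˡ-⊓ (d₁ a u₁) (d₂ x u₂) (d₂ y u₂)))

  distE-E₁-V₂ : ∀ {g c} → g ∈ E₁ → c ∈ V₂ → distE S g (r c) ≡ distE G₁ g u₁ + d₂ c u₂
  distE-E₁-V₂ {x , y} {c} g∈ c∈ with edge-endpoints simple₁ g∈
  ... | x∈ , y∈ = trans (cong₂ _⊓_ (dist-splice-V₁V₂ x∈ c∈) (dist-splice-V₁V₂ y∈ c∈))
                        (sym (+-distribʳ-⊓ (d₂ c u₂) (d₁ x u₁) (d₁ y u₁)))

  distE-E₂-V₂ : ∀ {g c} → g ∈ E₂ → c ∈ V₂ → distE S (R g) (r c) ≡ distE G₂ g c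
  distE-E₂-V₂ {x , y} g∈ c∈ with edge-endpoints simple₂ g∈
  ... | x∈ , y∈ = cong₂ _⊓_ (dist-splice-V₂ x∈ c∈) (dist-splice-V₂ y∈ c∈)

  count-edges : ∀ (p : Edge → Bool) → count p (edges S) ≡ count p E₁ + count (p ∘ R) E₂
  count-edges p = trans (count-++ p E₁ (map R E₂)) (cong (count p E₁ +_) (count-map p R E₂))

  m-splice-V₁ : ∀ {a b} → a ∈ V₁ → b ∈ V₁ → m S a b ≡ m G₁ a b + indicator (d₁ a u₁ <ᵇ d₁ b u₁) (length E₂)
  m-splice-V₁ {a} {b} a∈ b∈ =
    trans (count-edges (λ g → distE S g a <ᵇ distE S g b))
          (cong₂ _+_ (count-cong E₁ λ g∈ → cong₂ _<ᵇ_ (distE-E₁-V₁ g∈ a∈) (distE-E₁-V₁ g∈ b∈))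
                     (count-const E₂ λ {g} g∈ →
                       trans (cong₂ _<ᵇ_ (distE-E₂-V₁ g∈ a∈) (distE-E₂-V₁ g∈ b∈))
                             (+-cancelʳ-<ᵇ (distE G₂ g u₂) (d₁ a u₁) (d₁ b u₁))))

  m-splice-V₂ : ∀ {c d} → c ∈ V₂ → d ∈ V₂ → m S (r c) (r d) ≡ m G₂ c d + indicator (d₂ c u₂ <ᵇ d₂ d u₂) (length E₁)
  m-splice-V₂ {c} {d} c∈ d∈ =
    trans (count-edges P) (trans (+-comm (count P E₁) (count (P ∘ R) E₂))
            (cong₂ _+_ (count-cong E₂ λ g∈ → cong₂ _<ᵇ_ (distE-E₂-V₂ g∈ c∈) (distE-E₂-V₂ g∈ d∈))
                       (count-const E₁ λ {g} g∈ →
                         trans (cong₂ _<ᵇ_ (distE-E₁-V₂ g∈ c∈) (distE-E₁-V₂ g∈ d∈))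
                               (+-cancelˡ-<ᵇ (distE G₁ g u₁) (d₂ c u₂) (d₂ d u₂)))))
    where
    P : Edge → Bool
    P g = distE S g (r c) <ᵇ distE S g (r d)

  sum-edgePI-E₁ : sum (map (edgePI S) E₁) ≡ PI G₁ + tcount G₁ u₁ * length E₂
  sum-edgePI-E₁ = sum-map-split (edgePI S) (edgePI G₁) (λ e → not (d₁ (proj₁ e) u₁ ≡ᵇ d₁ (proj₂ e) u₁)) (length E₂) E₁
    λ { {a , b} ab∈ → let a∈ , b∈ = edge-endpoints simple₁ ab∈ in
          +-indicators-<ᵇ (d₁ a u₁) (d₁ b u₁) (length E₂) (m-splice-V₁ a∈ b∈) (m-splice-V₁ b∈ a∈) }

  sum-edgePI-E₂ : sum (map (edgePI S ∘ R) E₂) ≡ PI G₂ + tcount G₂ u₂ * length E₁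
  sum-edgePI-E₂ = sum-map-split (edgePI S ∘ R) (edgePI G₂) (λ e → not (d₂ (proj₁ e) u₂ ≡ᵇ d₂ (proj₂ e) u₂)) (length E₁) E₂
    λ { {c , d} cd∈ → let c∈ , d∈ = edge-endpoints simple₂ cd∈ in
          +-indicators-<ᵇ (d₂ c u₂) (d₂ d u₂) (length E₁) (m-splice-V₂ c∈ d∈) (m-splice-V₂ d∈ c∈) }

  PI-splice-edges : PI S ≡ sum (map (edgePI S) E₁) + sum (map (edgePI S ∘ R) E₂)
  PI-splice-edges = begin
    sum (map (edgePI S) (E₁ ++ map R E₂))                   ≡⟨ cong sum (map-++ (edgePI S) E₁ (map R E₂)) ⟩
    sum (map (edgePI S) E₁ ++ map (edgePI S) (map R E₂))    ≡⟨ sum-++ (map (edgePI S) E₁) _ ⟩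
    sum (map (edgePI S) E₁) + sum (map (edgePI S) (map R E₂)) ≡⟨ cong (λ es → sum (map (edgePI S) E₁) + sum es) (sym (map-∘ E₂)) ⟩
    sum (map (edgePI S) E₁) + sum (map (edgePI S ∘ R) E₂)  ∎
    where open ≡-Reasoning

proposition5 : (G₁ G₂ : Graph) → Simple G₁ → Simple G₂ → Connected G₁ → Connected G₂
    → Disjoint (verts G₁) (verts G₂) → (u₁ u₂ : ℕ) → u₁ ∈ verts G₁ → u₂ ∈ verts G₂
    → PI (splice G₁ G₂ u₁ u₂)
    ≡ PI G₁ + PI G₂ + tcount G₂ u₂ * length (edges G₁) + tcount G₁ u₁ * length (edges G₂)
proposition5 G₁ G₂ simple₁ simple₂ connected₁ connected₂ disjoint u₁ u₂ u₁∈ u₂∈ = begin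
  PI S                                                      ≡⟨ PI-splice-edges ⟩
  sum (map (edgePI S) E₁) + sum (map (edgePI S ∘ R) E₂)     ≡⟨ cong₂ _+_ sum-edgePI-E₁ sum-edgePI-E₂ ⟩
  (PI G₁ + t₁ * length E₂) + (PI G₂ + t₂ * length E₁)       ≡⟨ interchange (PI G₁) _ (PI G₂) _ ⟩
  (PI G₁ + PI G₂) + (t₁ * length E₂ + t₂ * length E₁)       ≡⟨ cong (PI G₁ + PI G₂ +_) (+-comm (t₁ * length E₂) _) ⟩
  (PI G₁ + PI G₂) + (t₂ * length E₁ + t₁ * length E₂)       ≡⟨ sym (+-assoc (PI G₁ + PI G₂) _ _) ⟩
  PI G₁ + PI G₂ + t₂ * length E₁ + t₁ * length E₂           ∎
  where
  open ≡-Reasoning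
  open Splice G₁ G₂ simple₁ simple₂ connected₁ connected₂ disjoint u₁ u₂ u₁∈ u₂∈
  t₁ t₂ : ℕ
  t₁ = tcount G₁ u₁
  t₂ = tcount G₂ u₂
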